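{- Let $U\subseteq\mathbb Z$ be infinite. If $f\in LIP(U)$ satisfies a nontrivial polynomial equation $a_n(x)f(x)^n+\dots+a_1(x)f(x)+a_0(x)=0$ for all $x\in U$, with $a_i\in\mathbb Z[x]$ not all zero, then $f$ coincides on $U$ with a polynomial in $\mathbb Z[x]$. That is, $\mathbb Z[x]$ is algebraically closed in $LIP(U)$.
   Context: For an infinite $U\subseteq\mathbb Z$, a function $f\colon U\to\mathbb Z$ is LIP on $U$ if for every finite $X\subseteq U$ there is $p\in\mathbb Z[x]$ with $p(x)=f(x)$ for all $x\in X$; $LIP(U)$ is the ring of such functions, containing $\mathbb Z[x]$ via evaluation on $U$. -}

module Defs where

open import Data.Integer using (ℤ; 0ℤ; _+_; _*_; _^_)
open import Data.Nat using (ℕ; zero; suc)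
open import Data.List using (List; []; _∷_)
open import Data.List.Membership.Propositional using (_∈_; _∉_)
open import Data.List.Relation.Unary.All using (All)
open import Data.List.Relation.Unary.Any using (Any)
open import Data.Product using (Σ; ∃; _×_)
open import Relation.Binary.PropositionalEquality using (_≡_; _≢_)

-- Polynomials in ℤ[x] as coefficient lists, constant term first:
-- [c₀ , c₁ , … , cₙ] represents c₀ + c₁ x + … + cₙ xⁿ.
Poly : Set
Poly = List ℤ

eval : Poly → ℤ → ℤ
eval []       x = 0ℤ
eval (c ∷ cs) x = c + x * eval cs x

IsZeroPoly : Poly → Set
IsZeroPoly p = All (_≡ 0ℤ) p

-- A subset U ⊆ ℤ is given as a predicate.
-- Infinite: no finite list exhausts U (constructive form of infiniteness).
Infinite : (ℤ → Set) → Set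
Infinite U = (xs : List ℤ) → ∃ λ x → U x × x ∉ xs

IsLIP : (ℤ → Set) → (ℤ → ℤ) → Set
IsLIP U f = (X : List ℤ) → All U X → ∃ λ (p : Poly) → (x : ℤ) → x ∈ X → eval p x ≡ f x

evalEq : List Poly → ℤ → ℤ → ℤ
evalEq []       x y = 0ℤ
evalEq (a ∷ as) x y = eval a x + y * evalEq as x y

Nontrivial : List Poly → Set
Nontrivial as = Any (λ a → Any (_≢ 0ℤ) a) as

-- If f satisfies a nontrivial equation Σ aᵢ(x) yⁱ = 0, the leading nonzero coefficient
-- dominates for large x, so |f(x)| ≤ S (1+|x|)^K on U.  Interpolate f at K+1 points of U
-- by a Newton polynomial T of degree ≤ K; its coefficients are integers because it is
-- obtained from an integer interpolant of f by repeated synthetic division.  For u ∈ U,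
-- interpolating f on u and the nodes shows ∏ (u − a) ∣ f(u) − T(u); for large u the
-- divisor outgrows the dividend, so f(u) = T(u).  For any other u ∈ U pick y ∈ U far
-- away: interpolation on {u, y} gives u − y ∣ f(u) − T(u), which forces f(u) = T(u).
module Submission where

open import Defs
open import Data.Integer
  using (ℤ; 0ℤ; 1ℤ; +_; -[1+_]; -_; _+_; _-_; _*_; ∣_∣; _≟_)
open import Data.Integer.Properties
  using ( +-assoc; +-identityˡ; +-identityʳ; *-zeroʳ; *-identityʳ; abs-*; ∣-i∣≡∣i∣
        ; ∣i∣≡0⇒i≡0; ∣i+j∣≤∣i∣+∣j∣; ∣i-j∣≤∣i∣+∣j∣; ∣i-j∣≡∣j-i∣
        ; i≡j⇒i-j≡0; i-j≡0⇒i≡j; i*j≡0⇒i≡0∨j≡0 )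
open import Data.Integer.Divisibility using (_∣_; *-monoʳ-∣)
open import Data.Integer.Tactic.RingSolver using (solve-∀)
open import Data.Nat as ℕ using (ℕ; zero; suc; pred; _≤_; _<_; _∸_; _^_; z≤n; s≤s)
import Data.Nat.Properties as ℕ
import Data.Nat.Divisibility as ℕ
import Data.Nat.Tactic.RingSolver as ℕ-Solver
open import Data.List using (List; []; _∷_; length; map)
open import Data.Nat.ListAction using (sum)
open import Data.List.Membership.Propositional using (_∈_)
open import Data.List.Relation.Unary.All as All using (All; []; _∷_)
open import Data.List.Relation.Unary.All.Properties using (¬Any⇒All¬)
open import Data.List.Relation.Unary.Any using (Any; here; there; any?)
open import Data.List.Relation.Unary.Unique.Propositional using (Unique)
open import Data.List.Relation.Unary.AllPairs using ([]; _∷_)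
open import Data.Product using (∃; _×_; _,_; proj₁; proj₂; uncurry)
open import Data.Sum using (inj₁; inj₂)
open import Function using (_∘_)
open import Relation.Nullary using (¬_; yes; no; contradiction)
open import Relation.Nullary.Decidable using (¬?; decidable-stable)
open import Relation.Binary.PropositionalEquality

-- Synthetic division and Newton interpolation

quot : Poly → ℤ → Poly
quot []       a = []
quot (c ∷ cs) a = eval cs a ∷ quot cs a

eval-quot : ∀ p a x → eval p x - eval p a ≡ (x - a) * eval (quot p a) x
eval-quot []       a x = sym (*-zeroʳ (x - a))
eval-quot (c ∷ cs) a x = begin
  (c + x * P) - (c + a * Pa)       ≡⟨ regroup c x a P Pa ⟩
  (x - a) * Pa + x * (P - Pa)      ≡⟨ cong (λ d → (x - a) * Pa + x * d) (eval-quot cs a x) ⟩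
  (x - a) * Pa + x * ((x - a) * Q) ≡⟨ factor x a Pa Q ⟩
  (x - a) * (Pa + x * Q)           ∎
  where
  open ≡-Reasoning
  P = eval cs x
  Pa = eval cs a
  Q = eval (quot cs a) x
  regroup : ∀ c x a P Pa → (c + x * P) - (c + a * Pa) ≡ (x - a) * Pa + x * (P - Pa)
  regroup = solve-∀
  factor : ∀ x a Pa Q → (x - a) * Pa + x * ((x - a) * Q) ≡ (x - a) * (Pa + x * Q)
  factor = solve-∀

eval-quot-sub : ∀ p q a u → eval p a ≡ eval q a →
  eval p u - eval q u ≡ (u - a) * (eval (quot p a) u - eval (quot q a) u)
eval-quot-sub p q a u pa≡qa = begin
  eval p u - eval q u                      ≡⟨ regroup (eval p u) (eval q u) (eval p a) ⟩
  (eval p u - eval p a) - (eval q u - eval p a)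
    ≡⟨ cong (λ t → (eval p u - eval p a) - (eval q u - t)) pa≡qa ⟩
  (eval p u - eval p a) - (eval q u - eval q a)
    ≡⟨ cong₂ _-_ (eval-quot p a u) (eval-quot q a u) ⟩
  (u - a) * eval (quot p a) u - (u - a) * eval (quot q a) u
    ≡⟨ factor (u - a) (eval (quot p a) u) (eval (quot q a) u) ⟩
  (u - a) * (eval (quot p a) u - eval (quot q a) u) ∎
  where
  open ≡-Reasoning
  regroup : ∀ P Q Pa → P - Q ≡ (P - Pa) - (Q - Pa)
  regroup = solve-∀
  factor : ∀ d A B → d * A - d * B ≡ d * (A - B)
  factor = solve-∀

quot-agree : ∀ p q {a b} → eval p a ≡ eval q a → a ≢ b → eval p b ≡ eval q b →
  eval (quot p a) b ≡ eval (quot q a) b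
quot-agree p q {a} {b} pa≡qa a≢b pb≡qb
  with i*j≡0⇒i≡0∨j≡0 (b - a) (trans (sym (eval-quot-sub p q a b pa≡qa)) (i≡j⇒i-j≡0 pb≡qb))
... | inj₁ b-a≡0 = contradiction (sym (i-j≡0⇒i≡j b a b-a≡0)) a≢b
... | inj₂ d≡0   = i-j≡0⇒i≡j _ _ d≡0

addConst : ℤ → Poly → Poly
addConst c []       = c ∷ []
addConst c (d ∷ ds) = c + d ∷ ds

eval-addConst : ∀ c p x → eval (addConst c p) x ≡ c + eval p x
eval-addConst c []       x = cong (_+_ c) (*-zeroʳ x)
eval-addConst c (d ∷ ds) x = +-assoc c d (x * eval ds x)

mulLinear : ℤ → Poly → Poly
mulLinear a []       = []
mulLinear a (d ∷ ds) = - a * d ∷ addConst d (mulLinear a ds)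

eval-mulLinear : ∀ a p x → eval (mulLinear a p) x ≡ (x - a) * eval p x
eval-mulLinear a []       x = sym (*-zeroʳ (x - a))
eval-mulLinear a (d ∷ ds) x = begin
  - a * d + x * eval (addConst d (mulLinear a ds)) x
    ≡⟨ cong (λ t → - a * d + x * t) (eval-addConst d (mulLinear a ds) x) ⟩
  - a * d + x * (d + eval (mulLinear a ds) x)
    ≡⟨ cong (λ t → - a * d + x * (d + t)) (eval-mulLinear a ds x) ⟩
  - a * d + x * (d + (x - a) * eval ds x) ≡⟨ expand a d x (eval ds x) ⟩
  (x - a) * (d + x * eval ds x)           ∎
  where
  open ≡-Reasoning
  expand : ∀ a d x D → - a * d + x * (d + (x - a) * D) ≡ (x - a) * (d + x * D)
  expand = solve-∀

newton : Poly → List ℤ → Poly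
newton r []       = []
newton r (a ∷ as) = addConst (eval r a) (mulLinear a (newton (quot r a) as))

eval-newton-∷ : ∀ r a as u →
  eval (newton r (a ∷ as)) u ≡ eval r a + (u - a) * eval (newton (quot r a) as) u
eval-newton-∷ r a as u = begin
  eval (newton r (a ∷ as)) u           ≡⟨ eval-addConst (eval r a) (mulLinear a N) u ⟩
  eval r a + eval (mulLinear a N) u    ≡⟨ cong (_+_ (eval r a)) (eval-mulLinear a N u) ⟩
  eval r a + (u - a) * eval N u        ∎
  where
  open ≡-Reasoning
  N = newton (quot r a) as

newton-agree : ∀ r xs {b} → b ∈ xs → eval (newton r xs) b ≡ eval r b
newton-agree r (a ∷ as) (here refl) = begin
  eval (newton r (a ∷ as)) a                          ≡⟨ eval-newton-∷ r a as a ⟩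
  eval r a + (a - a) * eval (newton (quot r a) as) a  ≡⟨ cancel (eval r a) a _ ⟩
  eval r a                                            ∎
  where
  open ≡-Reasoning
  cancel : ∀ R a N → R + (a - a) * N ≡ R
  cancel = solve-∀
newton-agree r (a ∷ as) {b} (there b∈as) = begin
  eval (newton r (a ∷ as)) b                     ≡⟨ eval-newton-∷ r a as b ⟩
  eval r a + (b - a) * eval (newton (quot r a) as) b
    ≡⟨ cong (λ t → eval r a + (b - a) * t) (newton-agree (quot r a) as b∈as) ⟩
  eval r a + (b - a) * eval (quot r a) b        ≡⟨ cong (_+_ (eval r a)) (eval-quot r a b) ⟨
  eval r a + (eval r b - eval r a)               ≡⟨ cancel (eval r a) (eval r b) ⟩
  eval r b                                       ∎
  where
  open ≡-Reasoning
  cancel : ∀ Ra Rb → Ra + (Rb - Ra) ≡ Rb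
  cancel = solve-∀

-- Divisibility by the node product

nodeProduct : List ℤ → ℤ → ℤ
nodeProduct []       u = 1ℤ
nodeProduct (a ∷ as) u = (u - a) * nodeProduct as u

nodeProduct-∣ : ∀ p q {xs} → Unique xs → All (λ a → eval p a ≡ eval q a) xs →
  ∀ u → nodeProduct xs u ∣ eval p u - eval q u
nodeProduct-∣ p q []             []           u = ℕ.1∣ _
nodeProduct-∣ p q {a ∷ as} (a≢as ∷ uniq) (pa≡qa ∷ agree) u =
  subst (nodeProduct (a ∷ as) u ∣_) (sym (eval-quot-sub p q a u pa≡qa))
    (*-monoʳ-∣ (u - a) (nodeProduct-∣ (quot p a) (quot q a) uniq quot-agrees u))
  where
  quot-agrees : All (λ b → eval (quot p a) b ≡ eval (quot q a) b) as
  quot-agrees = All.zipWith (uncurry (quot-agree p q pa≡qa)) (a≢as , agree)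

i∣j∧∣j∣<∣i∣⇒j≡0 : ∀ {i j} → i ∣ j → ∣ j ∣ < ∣ i ∣ → j ≡ 0ℤ
i∣j∧∣j∣<∣i∣⇒j≡0 {j = j} i∣j j<i with ∣ j ∣ in eq
... | zero  = ∣i∣≡0⇒i≡0 eq
... | suc _ = contradiction i∣j (ℕ.>⇒∤ j<i)

module _ {U : ℤ → Set} {f : ℤ → ℤ} (lip : IsLIP U f) (T : Poly) where

  lip-nodeProduct-∣ : ∀ {xs} → All U xs → Unique xs → All (λ a → f a ≡ eval T a) xs →
    ∀ {u} → U u → nodeProduct xs u ∣ f u - eval T u
  lip-nodeProduct-∣ {xs} Uxs uniq f≡T {u} Uu with lip (u ∷ xs) (Uu ∷ Uxs)
  ... | r , r≡f = subst (λ v → nodeProduct xs u ∣ v - eval T u) (r≡f u (here refl))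
    (nodeProduct-∣ r T uniq r≡T u)
    where
    r≡T : All (λ a → eval r a ≡ eval T a) xs
    r≡T = All.tabulate λ a∈xs → trans (r≡f _ (there a∈xs)) (All.lookup f≡T a∈xs)

  lip-agree : ∀ {xs} → All U xs → Unique xs → All (λ a → f a ≡ eval T a) xs →
    ∀ {u} → U u → ∣ f u - eval T u ∣ < ∣ nodeProduct xs u ∣ → f u ≡ eval T u
  lip-agree {xs} Uxs uniq f≡T {u} Uu small = i-j≡0⇒i≡j (f u) (eval T u)
    (i∣j∧∣j∣<∣i∣⇒j≡0 {nodeProduct xs u} (lip-nodeProduct-∣ Uxs uniq f≡T Uu) small)

-- Size estimates

sumAbs : List ℤ → ℕ
sumAbs cs = sum (map ∣_∣ cs)

∣i+j*k∣≤∣i∣+∣j∣*∣k∣ : ∀ i j k → ∣ i + j * k ∣ ≤ ∣ i ∣ ℕ.+ ∣ j ∣ ℕ.* ∣ k ∣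
∣i+j*k∣≤∣i∣+∣j∣*∣k∣ i j k =
  ℕ.≤-trans (∣i+j∣≤∣i∣+∣j∣ i (j * k)) (ℕ.≤-reflexive (cong (∣ i ∣ ℕ.+_) (abs-* j k)))

∣i∣≤∣j∣+∣i-j∣ : ∀ i j → ∣ i ∣ ≤ ∣ j ∣ ℕ.+ ∣ i - j ∣
∣i∣≤∣j∣+∣i-j∣ i j =
  subst (λ t → ∣ t ∣ ≤ ∣ j ∣ ℕ.+ ∣ i - j ∣) (regroup i j) (∣i+j∣≤∣i∣+∣j∣ j (i - j))
  where
  regroup : ∀ i j → j + (i - j) ≡ i
  regroup = solve-∀

m≤m*[1+n]^k : ∀ m n k → m ≤ m ℕ.* suc n ^ k
m≤m*[1+n]^k m n k = ℕ.m≤m*n m (suc n ^ k) {{ℕ.m^n≢0 (suc n) k}}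

∣eval∣≤ : ∀ p x → ∣ eval p x ∣ ≤ sumAbs p ℕ.* suc ∣ x ∣ ^ length p
∣eval∣≤ []       x = z≤n
∣eval∣≤ (c ∷ cs) x = begin
  ∣ c + x * eval cs x ∣                    ≤⟨ ∣i+j*k∣≤∣i∣+∣j∣*∣k∣ c x (eval cs x) ⟩
  ∣ c ∣ ℕ.+ ∣ x ∣ ℕ.* ∣ eval cs x ∣
    ≤⟨ ℕ.+-mono-≤ (m≤m*[1+n]^k ∣ c ∣ ∣ x ∣ (length (c ∷ cs)))
                  (ℕ.*-mono-≤ (ℕ.n≤1+n ∣ x ∣) (∣eval∣≤ cs x)) ⟩
  ∣ c ∣ ℕ.* (b ℕ.* P) ℕ.+ b ℕ.* (sumAbs cs ℕ.* P) ≡⟨ regroup ∣ c ∣ b (sumAbs cs) P ⟩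
  (∣ c ∣ ℕ.+ sumAbs cs) ℕ.* (b ℕ.* P)      ∎
  where
  open ℕ.≤-Reasoning
  b = suc ∣ x ∣
  P = b ^ length cs
  regroup : ∀ c b S P → c ℕ.* (b ℕ.* P) ℕ.+ b ℕ.* (S ℕ.* P) ≡ (c ℕ.+ S) ℕ.* (b ℕ.* P)
  regroup = ℕ-Solver.solve-∀

newton-bound : ∀ r xs →
  ∃ λ C → ∀ u → ∣ eval (newton r xs) u ∣ ≤ C ℕ.* suc ∣ u ∣ ^ pred (length xs)
newton-bound r []       = 0 , λ u → z≤n
newton-bound r (a ∷ []) = ∣ eval r a ∣ , λ u → ℕ.≤-reflexive (begin
  ∣ eval r a + u * 0ℤ ∣ ≡⟨ cong (λ t → ∣ eval r a + t ∣) (*-zeroʳ u) ⟩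
  ∣ eval r a + 0ℤ ∣     ≡⟨ cong ∣_∣ (+-identityʳ (eval r a)) ⟩
  ∣ eval r a ∣          ≡⟨ ℕ.*-identityʳ ∣ eval r a ∣ ⟨
  ∣ eval r a ∣ ℕ.* 1    ∎)
  where open ≡-Reasoning
newton-bound r (a ∷ a′ ∷ as) with newton-bound (quot r a) (a′ ∷ as)
... | C , bound = ∣ eval r a ∣ ℕ.+ suc ∣ a ∣ ℕ.* C , λ u →
  let open ℕ.≤-Reasoning
      b = suc ∣ u ∣
      P = b ^ length as
      N = eval (newton (quot r a) (a′ ∷ as)) u
  in begin
  ∣ eval (newton r (a ∷ a′ ∷ as)) u ∣ ≡⟨ cong ∣_∣ (eval-newton-∷ r a (a′ ∷ as) u) ⟩
  ∣ eval r a + (u - a) * N ∣           ≤⟨ ∣i+j*k∣≤∣i∣+∣j∣*∣k∣ (eval r a) (u - a) N ⟩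
  ∣ eval r a ∣ ℕ.+ ∣ u - a ∣ ℕ.* ∣ N ∣
    ≤⟨ ℕ.+-mono-≤ (m≤m*[1+n]^k ∣ eval r a ∣ ∣ u ∣ (suc (length as)))
                  (ℕ.*-mono-≤ (∣i-j∣≤[1+∣j∣]*[1+∣i∣] u a) (bound u)) ⟩
  ∣ eval r a ∣ ℕ.* (b ℕ.* P) ℕ.+ (suc ∣ a ∣ ℕ.* b) ℕ.* (C ℕ.* P)
    ≡⟨ regroup ∣ eval r a ∣ b P (suc ∣ a ∣) C ⟩
  (∣ eval r a ∣ ℕ.+ suc ∣ a ∣ ℕ.* C) ℕ.* (b ℕ.* P) ∎
  where
  regroup : ∀ R b P A C →
    R ℕ.* (b ℕ.* P) ℕ.+ (A ℕ.* b) ℕ.* (C ℕ.* P) ≡ (R ℕ.+ A ℕ.* C) ℕ.* (b ℕ.* P)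
  regroup = ℕ-Solver.solve-∀
  ∣i-j∣≤[1+∣j∣]*[1+∣i∣] : ∀ i j → ∣ i - j ∣ ≤ suc ∣ j ∣ ℕ.* suc ∣ i ∣
  ∣i-j∣≤[1+∣j∣]*[1+∣i∣] i j = ℕ.≤-trans (∣i-j∣≤∣i∣+∣j∣ i j)
      (ℕ.≤-trans (ℕ.m≤m+n (∣ i ∣ ℕ.+ ∣ j ∣) (suc (∣ j ∣ ℕ.* ∣ i ∣)))
                 (ℕ.≤-reflexive (expand ∣ i ∣ ∣ j ∣)))
    where
    expand : ∀ I J → (I ℕ.+ J) ℕ.+ suc (J ℕ.* I) ≡ suc J ℕ.* suc I
    expand = ℕ-Solver.solve-∀

∣∣≤sumAbs : ∀ xs → All (λ a → ∣ a ∣ ≤ sumAbs xs) xs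
∣∣≤sumAbs []       = []
∣∣≤sumAbs (a ∷ as) =
  ℕ.m≤m+n ∣ a ∣ (sumAbs as) ∷
  All.map (λ le → ℕ.≤-trans le (ℕ.m≤n+m (sumAbs as) ∣ a ∣)) (∣∣≤sumAbs as)

∣nodeProduct∣≥ : ∀ u X xs → All (λ a → ∣ a ∣ ≤ X) xs →
  (∣ u ∣ ∸ X) ^ length xs ≤ ∣ nodeProduct xs u ∣
∣nodeProduct∣≥ u X []       []             = ℕ.≤-refl
∣nodeProduct∣≥ u X (a ∷ as) (a≤X ∷ as≤X) rewrite abs-* (u - a) (nodeProduct as u) =
  ℕ.*-mono-≤ ∣u∣∸X≤∣u-a∣ (∣nodeProduct∣≥ u X as as≤X)
  where
  ∣u∣∸X≤∣u-a∣ : ∣ u ∣ ∸ X ≤ ∣ u - a ∣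
  ∣u∣∸X≤∣u-a∣ =
    ℕ.≤-trans (ℕ.∸-monoʳ-≤ ∣ u ∣ a≤X) (ℕ.m≤n+o⇒m∸n≤o ∣ u ∣ ∣ a ∣ (∣i∣≤∣j∣+∣i-j∣ u a))

^-distribʳ-* : ∀ m n k → (m ℕ.* n) ^ k ≡ m ^ k ℕ.* n ^ k
^-distribʳ-* m n zero    = refl
^-distribʳ-* m n (suc k) = begin
  m ℕ.* n ℕ.* (m ℕ.* n) ^ k      ≡⟨ cong (m ℕ.* n ℕ.*_) (^-distribʳ-* m n k) ⟩
  m ℕ.* n ℕ.* (m ^ k ℕ.* n ^ k)  ≡⟨ regroup m n (m ^ k) (n ^ k) ⟩
  m ℕ.* m ^ k ℕ.* (n ℕ.* n ^ k)  ∎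
  where
  open ≡-Reasoning
  regroup : ∀ m n M N → m ℕ.* n ℕ.* (M ℕ.* N) ≡ m ℕ.* M ℕ.* (n ℕ.* N)
  regroup = ℕ-Solver.solve-∀

-- With v = w ∸ X ≥ X + 1 we have 1 + w ≤ 2v, so D (1+w)^k ≤ D 2^k v^k < v^(k+1).
polynomial<power : ∀ D X k w → X ℕ.+ (X ℕ.+ D ℕ.* 2 ^ k) < w →
  D ℕ.* suc w ^ k < (w ∸ X) ^ suc k
polynomial<power D X k w far = begin-strict
  D ℕ.* suc w ^ k             ≤⟨ ℕ.*-monoʳ-≤ D (ℕ.^-monoˡ-≤ k 1+w≤2v) ⟩
  D ℕ.* (2 ℕ.* v) ^ k         ≡⟨ cong (D ℕ.*_) (^-distribʳ-* 2 v k) ⟩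
  D ℕ.* (2 ^ k ℕ.* v ^ k)     ≡⟨ ℕ.*-assoc D (2 ^ k) (v ^ k) ⟨
  D ℕ.* 2 ^ k ℕ.* v ^ k
    <⟨ ℕ.*-monoˡ-< (v ^ k) {{ℕ.m^n≢0 v k {{ℕ.>-nonZero 0<v}}}} D2^k<v ⟩
  v ℕ.* v ^ k                 ∎
  where
  open ℕ.≤-Reasoning
  v = w ∸ X
  X+D2^k<v : X ℕ.+ D ℕ.* 2 ^ k < v
  X+D2^k<v = subst (_< v) (ℕ.m+n∸m≡n X _) (ℕ.∸-monoˡ-< far (ℕ.m≤m+n X _))
  D2^k<v : D ℕ.* 2 ^ k < v
  D2^k<v = ℕ.≤-<-trans (ℕ.m≤n+m _ X) X+D2^k<v
  0<v : 0 < v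
  0<v = ℕ.≤-<-trans z≤n X+D2^k<v
  X≤w : X ≤ w
  X≤w = ℕ.≤-trans (ℕ.m≤m+n X _) (ℕ.<⇒≤ far)
  1+w≤2v : suc w ≤ 2 ℕ.* v
  1+w≤2v = begin
    suc w           ≡⟨ cong suc (ℕ.m+[n∸m]≡n X≤w) ⟨
    suc X ℕ.+ v     ≤⟨ ℕ.+-monoˡ-≤ v (ℕ.≤-trans (s≤s (ℕ.m≤m+n X _)) X+D2^k<v) ⟩
    v ℕ.+ v         ≡⟨ cong (v ℕ.+_) (ℕ.+-identityʳ v) ⟨
    2 ℕ.* v         ∎

-- Roots of the equation grow at most polynomially

eval-zeros : ∀ cs y → ¬ Any (_≢ 0ℤ) cs → eval cs y ≡ 0ℤ
eval-zeros []       y none = refl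
eval-zeros (c ∷ cs) y none = begin
  c + y * eval cs y ≡⟨ cong₂ (λ s t → s + y * t) c≡0 (eval-zeros cs y (none ∘ there)) ⟩
  0ℤ + y * 0ℤ       ≡⟨ cong (_+_ 0ℤ) (*-zeroʳ y) ⟩
  0ℤ                ∎
  where
  open ≡-Reasoning
  c≡0 : c ≡ 0ℤ
  c≡0 = decidable-stable (c ≟ 0ℤ) (none ∘ here)

∣i∣<∣j∣⇒i+j≢0 : ∀ i j → ∣ i ∣ < ∣ j ∣ → i + j ≢ 0ℤ
∣i∣<∣j∣⇒i+j≢0 i j lt i+j≡0 =
  ℕ.<-irrefl (trans (sym (∣-i∣≡∣i∣ i)) (cong ∣_∣ (sym j≡-i))) lt
  where
  j≡-i : j ≡ - i
  j≡-i = begin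
    j            ≡⟨ regroup i j ⟩
    (i + j) - i  ≡⟨ cong (_- i) i+j≡0 ⟩
    0ℤ - i       ≡⟨ +-identityˡ (- i) ⟩
    - i          ∎
    where
    open ≡-Reasoning
    regroup : ∀ i j → j ≡ (i + j) - i
    regroup = solve-∀

∣i∣≤∣i*j∣ : ∀ i {j} → j ≢ 0ℤ → ∣ i ∣ ≤ ∣ i * j ∣
∣i∣≤∣i*j∣ i {j} j≢0 = subst (∣ i ∣ ≤_) (sym (abs-* i j))
  (ℕ.m≤m*n ∣ i ∣ ∣ j ∣ {{ℕ.≢-nonZero (j≢0 ∘ ∣i∣≡0⇒i≡0)}})

-- Cauchy's bound: the top nonzero coefficient dominates once |y| exceeds Σ |cᵢ|.
eval≢0 : ∀ {cs} y → Any (_≢ 0ℤ) cs → sumAbs cs < ∣ y ∣ → eval cs y ≢ 0ℤ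
eval≢0 {c ∷ cs} y nonzero big with any? (λ d → ¬? (d ≟ 0ℤ)) cs
... | yes nonzero′ = ∣i∣<∣j∣⇒i+j≢0 c (y * eval cs y)
  (ℕ.<-≤-trans (ℕ.≤-<-trans (ℕ.m≤m+n ∣ c ∣ _) big)
    (∣i∣≤∣i*j∣ y (eval≢0 y nonzero′ (ℕ.≤-<-trans (ℕ.m≤n+m _ ∣ c ∣) big))))
... | no zeros = λ eq → head≢0 nonzero (trans (sym value≡c) eq)
  where
  open ≡-Reasoning
  head≢0 : Any (_≢ 0ℤ) (c ∷ cs) → c ≢ 0ℤ
  head≢0 (here c≢0)     = c≢0
  head≢0 (there nonzero) = contradiction nonzero zeros
  value≡c : c + y * eval cs y ≡ c
  value≡c = begin
    c + y * eval cs y ≡⟨ cong (λ t → c + y * t) (eval-zeros cs y zeros) ⟩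
    c + y * 0ℤ        ≡⟨ cong (_+_ c) (*-zeroʳ y) ⟩
    c + 0ℤ            ≡⟨ +-identityʳ c ⟩
    c                 ∎

coefficientsAt : List Poly → ℤ → List ℤ
coefficientsAt as x = map (λ a → eval a x) as

evalEq≡eval-coefficientsAt : ∀ as x y → evalEq as x y ≡ eval (coefficientsAt as x) y
evalEq≡eval-coefficientsAt []       x y = refl
evalEq≡eval-coefficientsAt (a ∷ as) x y =
  cong (λ t → eval a x + y * t) (evalEq≡eval-coefficientsAt as x y)

totalSumAbs : List Poly → ℕ
totalSumAbs as = sum (map sumAbs as)

totalLength : List Poly → ℕ
totalLength as = sum (map length as)

coefficientsAt-nonzero : ∀ {as} x → Nontrivial as → totalSumAbs as < ∣ x ∣ →
  Any (_≢ 0ℤ) (coefficientsAt as x)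
coefficientsAt-nonzero x (here nonzero) big =
  here (eval≢0 x nonzero (ℕ.≤-<-trans (ℕ.m≤m+n _ _) big))
coefficientsAt-nonzero x (there nontrivial) big =
  there (coefficientsAt-nonzero x nontrivial (ℕ.≤-<-trans (ℕ.m≤n+m _ _) big))

sumAbs-coefficientsAt : ∀ as x →
  sumAbs (coefficientsAt as x) ≤ totalSumAbs as ℕ.* suc ∣ x ∣ ^ totalLength as
sumAbs-coefficientsAt []       x = z≤n
sumAbs-coefficientsAt (a ∷ as) x = begin
  ∣ eval a x ∣ ℕ.+ sumAbs (coefficientsAt as x)
    ≤⟨ ℕ.+-mono-≤ (∣eval∣≤ a x) (sumAbs-coefficientsAt as x) ⟩
  sumAbs a ℕ.* b ^ length a ℕ.+ totalSumAbs as ℕ.* b ^ totalLength as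
    ≤⟨ ℕ.+-mono-≤ (ℕ.*-monoʳ-≤ (sumAbs a) (ℕ.^-monoʳ-≤ b (ℕ.m≤m+n (length a) K′)))
                  (ℕ.*-monoʳ-≤ (totalSumAbs as) (ℕ.^-monoʳ-≤ b (ℕ.m≤n+m K′ (length a)))) ⟩
  sumAbs a ℕ.* b ^ K ℕ.+ totalSumAbs as ℕ.* b ^ K ≡⟨ ℕ.*-distribʳ-+ (b ^ K) (sumAbs a) _ ⟨
  totalSumAbs (a ∷ as) ℕ.* b ^ K                ∎
  where
  open ℕ.≤-Reasoning
  b = suc ∣ x ∣
  K′ = totalLength as
  K = totalLength (a ∷ as)

root-bound : ∀ {as} x y → Nontrivial as → totalSumAbs as < ∣ x ∣ → evalEq as x y ≡ 0ℤ →
  ∣ y ∣ ≤ totalSumAbs as ℕ.* suc ∣ x ∣ ^ totalLength as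
root-bound {as} x y nontrivial big root = ℕ.≮⇒≥ λ y-big →
  eval≢0 y (coefficientsAt-nonzero x nontrivial big)
    (ℕ.≤-<-trans (sumAbs-coefficientsAt as x) y-big)
    (trans (sym (evalEq≡eval-coefficientsAt as x y)) root)

-- Agreement with the interpolant

distinctPoints : ∀ {U} → Infinite U → ∀ n → ∃ λ xs → length xs ≡ n × All U xs × Unique xs
distinctPoints inf zero = [] , refl , [] , []
distinctPoints inf (suc n) with distinctPoints inf n
... | xs , refl , Uxs , uniq with inf xs
... | x , Ux , x∉xs = x ∷ xs , refl , Ux ∷ Uxs , ¬Any⇒All¬ xs x∉xs ∷ uniq

absAtMost : ℕ → List ℤ
absAtMost zero    = + 0 ∷ []
absAtMost (suc n) = + suc n ∷ -[1+ n ] ∷ absAtMost n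

∈-absAtMost : ∀ B z → ∣ z ∣ ≤ B → z ∈ absAtMost B
∈-absAtMost zero    z         z≤0 = here (∣i∣≡0⇒i≡0 (ℕ.n≤0⇒n≡0 z≤0))
∈-absAtMost (suc n) (+ m)     m≤n with m ℕ.≟ suc n
... | yes refl = here refl
... | no  m≢n  = there (there (∈-absAtMost n (+ m) (ℕ.≤-pred (ℕ.≤∧≢⇒< m≤n m≢n))))
∈-absAtMost (suc n) -[1+ m ]  m<n with m ℕ.≟ n
... | yes refl = there (here refl)
... | no  m≢n  = there (there (∈-absAtMost n -[1+ m ] (ℕ.≤∧≢⇒< (ℕ.≤-pred m<n) m≢n)))

unbounded : ∀ {U} → Infinite U → ∀ B → ∃ λ y → U y × B < ∣ y ∣
unbounded inf B with inf (absAtMost B)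
... | y , Uy , y∉ = y , Uy , ℕ.≰⇒> (y∉ ∘ ∈-absAtMost B y)

agree-far : ∀ {U f} → IsLIP U f → (T : Poly) (S C : ℕ) → ∀ {xs k} →
  All U xs → Unique xs → length xs ≡ suc k → All (λ a → f a ≡ eval T a) xs →
  (∀ u → ∣ eval T u ∣ ≤ C ℕ.* suc ∣ u ∣ ^ k) →
  ∀ {u} → U u → ∣ f u ∣ ≤ S ℕ.* suc ∣ u ∣ ^ k →
  sumAbs xs ℕ.+ (sumAbs xs ℕ.+ (S ℕ.+ C) ℕ.* 2 ^ k) < ∣ u ∣ → f u ≡ eval T u
agree-far {f = f} lip T S C {xs} {k} Uxs uniq len f≡T T-bound {u} Uu f-bound far =
  lip-agree lip T Uxs uniq f≡T Uu (begin-strict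
    ∣ f u - eval T u ∣              ≤⟨ ∣i-j∣≤∣i∣+∣j∣ (f u) (eval T u) ⟩
    ∣ f u ∣ ℕ.+ ∣ eval T u ∣        ≤⟨ ℕ.+-mono-≤ f-bound (T-bound u) ⟩
    S ℕ.* b ^ k ℕ.+ C ℕ.* b ^ k     ≡⟨ ℕ.*-distribʳ-+ (b ^ k) S C ⟨
    (S ℕ.+ C) ℕ.* b ^ k             <⟨ polynomial<power (S ℕ.+ C) X k ∣ u ∣ far ⟩
    (∣ u ∣ ∸ X) ^ suc k             ≡⟨ cong ((∣ u ∣ ∸ X) ^_) len ⟨
    (∣ u ∣ ∸ X) ^ length xs         ≤⟨ ∣nodeProduct∣≥ u X xs (∣∣≤sumAbs xs) ⟩
    ∣ nodeProduct xs u ∣            ∎)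
  where
  open ℕ.≤-Reasoning
  b = suc ∣ u ∣
  X = sumAbs xs

agree-everywhere : ∀ {U f} → Infinite U → IsLIP U f → (T : Poly) (B : ℕ) →
  (∀ y → U y → B < ∣ y ∣ → f y ≡ eval T y) → ∀ u → U u → f u ≡ eval T u
agree-everywhere {f = f} inf lip T B agree-beyond-B u Uu
  with unbounded inf (B ℕ.+ (∣ u ∣ ℕ.+ ∣ f u - eval T u ∣))
... | y , Uy , far = lip-agree lip T (Uy ∷ []) ([] ∷ []) (f≡T-at-y ∷ []) Uu (begin-strict
  ∣ f u - eval T u ∣
    <⟨ ℕ.+-cancelˡ-< ∣ u ∣ _ _ (ℕ.<-≤-trans u+d<y (∣i∣≤∣j∣+∣i-j∣ y u)) ⟩
  ∣ y - u ∣                        ≡⟨ ∣i-j∣≡∣j-i∣ y u ⟩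
  ∣ u - y ∣                        ≡⟨ cong ∣_∣ (*-identityʳ (u - y)) ⟨
  ∣ nodeProduct (y ∷ []) u ∣       ∎)
  where
  open ℕ.≤-Reasoning
  u+d<y : ∣ u ∣ ℕ.+ ∣ f u - eval T u ∣ < ∣ y ∣
  u+d<y = ℕ.≤-<-trans (ℕ.m≤n+m _ B) far
  f≡T-at-y : f y ≡ eval T y
  f≡T-at-y = agree-beyond-B y Uy (ℕ.≤-<-trans (ℕ.m≤m+n B _) far)

corollary3 : (U : ℤ → Set) → Infinite U → (f : ℤ → ℤ) → IsLIP U f →
    (as : List Poly) → Nontrivial as →
    ((x : ℤ) → U x → evalEq as x (f x) ≡ 0ℤ) →
    ∃ λ (p : Poly) → (x : ℤ) → U x → f x ≡ eval p x
corollary3 U inf f lip as nontrivial root with distinctPoints inf (suc (totalLength as))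
... | xs , len , Uxs , uniq with lip xs Uxs
... | r , r≡f = T , agree-everywhere inf lip T B f≡T-far
  where
  T = newton r xs
  S = totalSumAbs as
  K = totalLength as
  C = proj₁ (newton-bound r xs)
  X = sumAbs xs
  B = S ℕ.+ (X ℕ.+ (X ℕ.+ (S ℕ.+ C) ℕ.* 2 ^ K))
  T-bound : ∀ u → ∣ eval T u ∣ ≤ C ℕ.* suc ∣ u ∣ ^ K
  T-bound u = subst (λ e → ∣ eval T u ∣ ≤ C ℕ.* suc ∣ u ∣ ^ e) (cong pred len)
                    (proj₂ (newton-bound r xs) u)
  f≡T : All (λ a → f a ≡ eval T a) xs
  f≡T = All.tabulate λ a∈xs → trans (sym (r≡f _ a∈xs)) (sym (newton-agree r xs a∈xs))
  f≡T-far : ∀ y → U y → B < ∣ y ∣ → f y ≡ eval T y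
  f≡T-far y Uy far = agree-far lip T S C Uxs uniq len f≡T T-bound Uy
    (root-bound y (f y) nontrivial (ℕ.≤-<-trans (ℕ.m≤m+n S _) far) (root y Uy))
    (ℕ.≤-<-trans (ℕ.m≤n+m _ S) far)
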